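{- Let $\#$ be a parametrized monad on a category $\mathbf{C}$ with finite coproducts. Free complete Elgot $\#$-algebras exist for all objects $A$ of $\mathbf{C}$ if and only if final coalgebras $\mathsf{out}_A:\Phi A\to A\#\Phi A$ of the functors $A\#(-)$ exist for all $A$. In that case the free complete Elgot $\#$-algebra on $A$ is \[FA=\bigl(\Phi A,\ \mathsf{out}_A^{ -1}\circ m^{\Phi A}_A\circ(\mathsf{out}_A\#\mathrm{id}_{\Phi A}),\ (-)^\dagger\bigr),\] where for $e:X\to\Phi Y\# X$ one defines $e^\dagger=(\mathrm{coit}\,c)\circ\mathsf{inr}:X\to\Phi Y$, with $c:\Phi Y+X\to Y\#(\Phi Y+X)$ the coalgebra \[c=m^{\Phi Y+X}_Y\circ\bigl((\mathrm{id}_Y\#\mathsf{inl})\#\mathsf{inr}\bigr)\circ(\mathsf{out}_Y\#\mathrm{id}_X)\circ[u^X_{\Phi Y},e],\] and $\mathrm{coit}\,c:\Phi Y+X\to\Phi Y$ is the unique coalgebra morphism into $(\Phi Y,\mathsf{out}_Y)$.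
   Context: A parametrized monad is a bifunctor $\#:\mathbf{C}\times\mathbf{C}\to\mathbf{C}$ such that each $(-)\#X$ is a monad with unit $u^X_A:A\to A\#X$ and multiplication $m^X_A:(A\#X)\#X\to A\#X$, and for each $f:X\to Y$ the family $(\mathrm{id}_Z\#f)_Z$ is a monad morphism. A $\#$-algebra is $(A,a)$ with $a:A\#A\to A$, $a\circ u^A_A=\mathrm{id}$, $a\circ(a\#\mathrm{id})=a\circ m^A_A$. A complete Elgot $\#$-algebra is a $\#$-algebra $(A,a)$ with an operator sending each $e:X\to A\#X$ to $e^\dagger:X\to A$ such that: (solution) $e^\dagger=a\circ(\mathrm{id}_A\#e^\dagger)\circ e$; (functoriality) for $e:X\to A\#X$, $f:Y\to A\#Y$, $h:X\to Y$, if $f\circ h=(\mathrm{id}_A\#h)\circ e$ then $f^\dagger\circ h=e^\dagger$; (compositionality) for $f:Y\to A\#Y$, $g:X\to Y\#X$, with $f^\dagger\bullet g=(f^\dagger\#\mathrm{id}_X)\circ g$ and $f\blacksquare g=m^{Y+X}_A\circ(((\mathrm{id}_A\#\mathsf{inl})\circ f)\#\mathsf{inr})\circ[u^X_Y,g]$, one has $(f\blacksquare g)^\dagger\circ\mathsf{inr}=(f^\dagger\bullet g)^\dagger$. Morphisms $(A,a,\dagger)\to(B,b,\ddagger)$ are $f:A\to B$ with $((f\#\mathrm{id}_X)\circ e)^\ddagger=f\circ e^\dagger$ for all $e$. A free complete Elgot $\#$-algebra on $A$ is a complete Elgot $\#$-algebra $FA$ with $\eta_A:A\to FA$ such that every morphism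 $g:A\to B$ into a complete Elgot $\#$-algebra extends uniquely along $\eta_A$ to a morphism of complete Elgot $\#$-algebras. -}

module Defs where

open import Level using (Level; _⊔_; suc)
open import Relation.Binary using (Rel; IsEquivalence)
open import Data.Product using (Σ; _×_; _,_)

record Category (o ℓ e : Level) : Set (suc (o ⊔ ℓ ⊔ e)) where
  infix  4 _≈_
  infixr 9 _∘_
  infix  4 _⇒_
  field
    Obj           : Set o
    _⇒_           : Obj → Obj → Set ℓ
    _≈_           : ∀ {A B} → Rel (A ⇒ B) e
    id            : ∀ {A} → A ⇒ A
    _∘_           : ∀ {A B C} → B ⇒ C → A ⇒ B → A ⇒ C
    isEquivalence : ∀ {A B} → IsEquivalence (_≈_ {A} {B})
    assoc         : ∀ {A B C D} {f : A ⇒ B} {g : B ⇒ C} {h : C ⇒ D} →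
                    (h ∘ g) ∘ f ≈ h ∘ (g ∘ f)
    identityˡ     : ∀ {A B} {f : A ⇒ B} → id ∘ f ≈ f
    identityʳ     : ∀ {A B} {f : A ⇒ B} → f ∘ id ≈ f
    ∘-resp-≈      : ∀ {A B C} {f h : B ⇒ C} {g i : A ⇒ B} →
                    f ≈ h → g ≈ i → f ∘ g ≈ h ∘ i

record FiniteCoproducts {o ℓ e} (C : Category o ℓ e) : Set (o ⊔ ℓ ⊔ e) where
  open Category C
  infixr 6 _+_
  field
    ⊥        : Obj
    ¡        : ∀ {A} → ⊥ ⇒ A
    ¡-unique : ∀ {A} (f : ⊥ ⇒ A) → ¡ ≈ f
    _+_      : Obj → Obj → Obj
    inl      : ∀ {A B} → A ⇒ A + B
    inr      : ∀ {A B} → B ⇒ A + B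
    [_,_]    : ∀ {A B D} → A ⇒ D → B ⇒ D → A + B ⇒ D
    inject₁  : ∀ {A B D} {f : A ⇒ D} {g : B ⇒ D} → [ f , g ] ∘ inl ≈ f
    inject₂  : ∀ {A B D} {f : A ⇒ D} {g : B ⇒ D} → [ f , g ] ∘ inr ≈ g
    []-unique : ∀ {A B D} {f : A ⇒ D} {g : B ⇒ D} {h : A + B ⇒ D} →
                h ∘ inl ≈ f → h ∘ inr ≈ g → [ f , g ] ≈ h

-- A parametrized monad: a bifunctor # such that each (-) # X is a monad
-- (unit u X A : A → A # X, multiplication m X A : (A # X) # X → A # X),
-- and for each f : X → Y the family (id_Z # f)_Z is a monad morphism.
record ParametrizedMonad {o ℓ e} (C : Category o ℓ e) : Set (o ⊔ ℓ ⊔ e) where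
  open Category C
  infixl 7 _#_ _#₁_
  field
    _#_   : Obj → Obj → Obj
    _#₁_  : ∀ {A B X Y} → A ⇒ B → X ⇒ Y → (A # X) ⇒ (B # Y)
    #-identity     : ∀ {A X} → id {A} #₁ id {X} ≈ id
    #-homomorphism : ∀ {A B D X Y Z} {f : B ⇒ D} {g : A ⇒ B} {h : Y ⇒ Z} {k : X ⇒ Y} →
                     (f ∘ g) #₁ (h ∘ k) ≈ (f #₁ h) ∘ (g #₁ k)
    #-resp-≈       : ∀ {A B X Y} {f f' : A ⇒ B} {g g' : X ⇒ Y} →
                     f ≈ f' → g ≈ g' → f #₁ g ≈ f' #₁ g'
    u : ∀ X A → A ⇒ A # X
    m : ∀ X A → (A # X) # X ⇒ A # X
    u-natural : ∀ {X A B} (f : A ⇒ B) → (f #₁ id {X}) ∘ u X A ≈ u X B ∘ f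
    m-natural : ∀ {X A B} (f : A ⇒ B) →
                (f #₁ id {X}) ∘ m X A ≈ m X B ∘ ((f #₁ id) #₁ id)
    identityˡ-m : ∀ {X A} → m X A ∘ u X (A # X) ≈ id
    identityʳ-m : ∀ {X A} → m X A ∘ (u X A #₁ id) ≈ id
    assoc-m     : ∀ {X A} → m X A ∘ (m X A #₁ id) ≈ m X A ∘ m X (A # X)
    mm-unit : ∀ {X Y Z} (f : X ⇒ Y) → (id {Z} #₁ f) ∘ u X Z ≈ u Y Z
    mm-mult : ∀ {X Y Z} (f : X ⇒ Y) →
              (id {Z} #₁ f) ∘ m X Z ≈ m Y Z ∘ ((id #₁ f) #₁ f)

module Elgot {o ℓ e} (C : Category o ℓ e) (cp : FiniteCoproducts C)
             (P : ParametrizedMonad C) where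
  open Category C
  open FiniteCoproducts cp
  open ParametrizedMonad P

  _■_ : ∀ {A X Y} → Y ⇒ A # Y → X ⇒ Y # X → (Y + X) ⇒ A # (Y + X)
  _■_ {A} {X} {Y} f g = m (Y + X) A ∘ (((id #₁ inl) ∘ f) #₁ inr) ∘ [ u X Y , g ]

  _•_ : ∀ {A X Y} → Y ⇒ A → X ⇒ Y # X → X ⇒ A # X
  h • g = (h #₁ id) ∘ g

  record IsCompleteElgot (A : Obj) (a : A # A ⇒ A)
         (_† : ∀ {X} → X ⇒ A # X → X ⇒ A) : Set (o ⊔ ℓ ⊔ e) where
    field
      unit-law : a ∘ u A A ≈ id
      mult-law : a ∘ (a #₁ id) ≈ a ∘ m A A
      solution : ∀ {X} (e : X ⇒ A # X) → e † ≈ a ∘ (id #₁ (e †)) ∘ e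
      functoriality : ∀ {X Y} (e : X ⇒ A # X) (f : Y ⇒ A # Y) (h : X ⇒ Y) →
                      f ∘ h ≈ (id #₁ h) ∘ e → (f †) ∘ h ≈ e †
      compositionality : ∀ {X Y} (f : Y ⇒ A # Y) (g : X ⇒ Y # X) →
                         ((f ■ g) †) ∘ inr ≈ ((f †) • g) †

  record CompleteElgot : Set (o ⊔ ℓ ⊔ e) where
    field
      carrier : Obj
      alg     : carrier # carrier ⇒ carrier
      dagger  : ∀ {X} → X ⇒ carrier # X → X ⇒ carrier
      isCompleteElgot : IsCompleteElgot carrier alg dagger

  open CompleteElgot

  IsMorphism : (A B : CompleteElgot) → carrier A ⇒ carrier B → Set (o ⊔ ℓ ⊔ e)
  IsMorphism A B f = ∀ {X} (e : X ⇒ carrier A # X) →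
                     dagger B ((f #₁ id) ∘ e) ≈ f ∘ dagger A e

  IsFree : (A : Obj) (F : CompleteElgot) → A ⇒ carrier F → Set (o ⊔ ℓ ⊔ e)
  IsFree A F η = ∀ (B : CompleteElgot) (g : A ⇒ carrier B) →
    Σ (carrier F ⇒ carrier B) λ h →
      IsMorphism F B h × (h ∘ η ≈ g) ×
      (∀ (h' : carrier F ⇒ carrier B) → IsMorphism F B h' → h' ∘ η ≈ g → h' ≈ h)

  FreeElgot : Obj → Set (o ⊔ ℓ ⊔ e)
  FreeElgot A = Σ CompleteElgot λ F → Σ (A ⇒ carrier F) λ η → IsFree A F η

  record FinalCoalgebra (A : Obj) : Set (o ⊔ ℓ ⊔ e) where
    field
      Φ    : Obj
      out  : Φ ⇒ A # Φ
      coit : ∀ {X} → X ⇒ A # X → X ⇒ Φ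
      coit-hom    : ∀ {X} (c : X ⇒ A # X) → out ∘ coit c ≈ (id #₁ coit c) ∘ c
      coit-unique : ∀ {X} (c : X ⇒ A # X) (h : X ⇒ Φ) →
                    out ∘ h ≈ (id #₁ h) ∘ c → h ≈ coit c

    -- out⁻¹ (Lambek): the coalgebra morphism (A # Φ, id # out) → (Φ, out)
    out⁻¹ : A # Φ ⇒ Φ
    out⁻¹ = coit (id #₁ out)

  module FromFinal (fc : ∀ A → FinalCoalgebra A) where
    open FinalCoalgebra

    ΦF : Obj → Obj
    ΦF A = Φ (fc A)

    aF : ∀ A → ΦF A # ΦF A ⇒ ΦF A
    aF A = out⁻¹ (fc A) ∘ m (ΦF A) A ∘ (out (fc A) #₁ id)

    cF : ∀ Y {X} → X ⇒ ΦF Y # X → (ΦF Y + X) ⇒ Y # (ΦF Y + X)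
    cF Y {X} e = m (ΦF Y + X) Y ∘ ((id #₁ inl) #₁ inr) ∘ (out (fc Y) #₁ id)
                 ∘ [ u X (ΦF Y) , e ]

    daggerF : ∀ Y {X} → X ⇒ ΦF Y # X → X ⇒ ΦF Y
    daggerF Y e = coit (fc Y) (cF Y e) ∘ inr

    FA : ∀ A → IsCompleteElgot (ΦF A) (aF A) (daggerF A) → CompleteElgot
    FA A isE = record { carrier = ΦF A ; alg = aF A ; dagger = daggerF A
                      ; isCompleteElgot = isE }

-- Both directions rest on the fact that the coalgebra c of the statement is
-- out ■ e, so that compositionality and functoriality can be used with the
-- morphisms out of out ■ e that are the identity on the first summand: these
-- are exactly the copairings [ id , s ] with s a solution of e "in the
-- coalgebra out", i.e. out ∘ s ≈ m ∘ (out # s) ∘ e.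
--
-- Final ⇒ free: by Lambek's lemma the algebra aF satisfies out ∘ aF ≈ m ∘ (out # id),
-- so the solutions of e for aF are the solutions in out, and by finality these
-- are uniquely the second component of coit (out ■ e).  Unique solutions make
-- a complete Elgot algebra; the extension of g : A → B is ((g # id) ∘ out)†.
--
-- Free ⇒ final: on the free algebra T over A, the object A # T is again a
-- complete Elgot algebra (via ι = α ∘ (η # id) : A # T → T), and out : T → A # T
-- is the extension of the unit.  Then ι ∘ out ≈ id and coit c := ((η # id) ∘ c)†,
-- and uniqueness of coit comes from ((η # id) ∘ out)† ≈ id, both by freeness.
module Submission where

open import Defs
open import Data.Product using (Σ; _×_; _,_; proj₁; proj₂)
open import Function.Bundles using (_⇔_; mk⇔)
open import Relation.Binary using (Setoid; IsEquivalence)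
import Relation.Binary.Reasoning.Setoid as SetoidReasoning

module CategoryReasoning {o ℓ ℓe} (C : Category o ℓ ℓe) where
  open Category C

  hom-setoid : Obj → Obj → Setoid ℓ ℓe
  hom-setoid A B = record { Carrier = A ⇒ B ; _≈_ = _≈_ ; isEquivalence = isEquivalence }

  module _ {A B : Obj} where
    open IsEquivalence (isEquivalence {A} {B}) public
      using () renaming (refl to ≈-refl; sym to ≈-sym; trans to ≈-trans)
    open SetoidReasoning (hom-setoid A B) public

  infixr 4 _⟩∘⟨_ refl⟩∘⟨_
  infixl 5 _⟩∘⟨refl

  _⟩∘⟨_ : ∀ {A B D} {f h : B ⇒ D} {g i : A ⇒ B} → f ≈ h → g ≈ i → f ∘ g ≈ h ∘ i
  _⟩∘⟨_ = ∘-resp-≈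

  refl⟩∘⟨_ : ∀ {A B D} {f : B ⇒ D} {g i : A ⇒ B} → g ≈ i → f ∘ g ≈ f ∘ i
  refl⟩∘⟨ p = ∘-resp-≈ ≈-refl p

  _⟩∘⟨refl : ∀ {A B D} {f h : B ⇒ D} {g : A ⇒ B} → f ≈ h → f ∘ g ≈ h ∘ g
  p ⟩∘⟨refl = ∘-resp-≈ p ≈-refl

  sym-assoc : ∀ {A B D E} {f : A ⇒ B} {g : B ⇒ D} {h : D ⇒ E} → h ∘ (g ∘ f) ≈ (h ∘ g) ∘ f
  sym-assoc = ≈-sym assoc

  pullˡ : ∀ {A B D E} {a : D ⇒ E} {b : B ⇒ D} {c : B ⇒ E} → a ∘ b ≈ c →
          ∀ {f : A ⇒ B} → a ∘ b ∘ f ≈ c ∘ f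
  pullˡ p = ≈-trans sym-assoc (p ⟩∘⟨refl)

  pushˡ : ∀ {A B D E} {a : D ⇒ E} {b : B ⇒ D} {c : B ⇒ E} → c ≈ a ∘ b →
          ∀ {f : A ⇒ B} → c ∘ f ≈ a ∘ b ∘ f
  pushˡ p = ≈-sym (pullˡ (≈-sym p))

  pullʳ : ∀ {A B D E} {a : D ⇒ E} {b : B ⇒ D} {c : A ⇒ B} {d : A ⇒ D} → b ∘ c ≈ d →
          (a ∘ b) ∘ c ≈ a ∘ d
  pullʳ p = ≈-trans assoc (refl⟩∘⟨ p)

  cancelˡ : ∀ {A B} {a : B ⇒ A} {b : A ⇒ B} → a ∘ b ≈ id → ∀ {D} {f : D ⇒ A} → a ∘ b ∘ f ≈ f
  cancelˡ p = ≈-trans (pullˡ p) identityˡ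

  elimˡ : ∀ {A B} {a : B ⇒ B} {f : A ⇒ B} → a ≈ id → a ∘ f ≈ f
  elimˡ p = ≈-trans (p ⟩∘⟨refl) identityˡ

  elimʳ : ∀ {A B} {a : A ⇒ A} {f : A ⇒ B} → a ≈ id → f ∘ a ≈ f
  elimʳ p = ≈-trans (refl⟩∘⟨ p) identityʳ

module ParametrizedMonadLemmas {o ℓ ℓe} {C : Category o ℓ ℓe} (P : ParametrizedMonad C) where
  open Category C
  open ParametrizedMonad P
  open CategoryReasoning C

  infixr 6 _⟩#⟨_
  _⟩#⟨_ : ∀ {A B X Y} {f f' : A ⇒ B} {g g' : X ⇒ Y} → f ≈ f' → g ≈ g' → f #₁ g ≈ f' #₁ g'
  _⟩#⟨_ = #-resp-≈

  #-∘ : ∀ {A B D X Y Z} {f : B ⇒ D} {g : A ⇒ B} {h : Y ⇒ Z} {k : X ⇒ Y} →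
        (f #₁ h) ∘ (g #₁ k) ≈ (f ∘ g) #₁ (h ∘ k)
  #-∘ = ≈-sym #-homomorphism

  #id-∘ : ∀ {A B D X} {f : B ⇒ D} {g : A ⇒ B} → (f ∘ g) #₁ id {X} ≈ (f #₁ id) ∘ (g #₁ id)
  #id-∘ = ≈-trans (≈-refl ⟩#⟨ ≈-sym identityˡ) #-homomorphism

  id#-∘ : ∀ {A X Y Z} {h : Y ⇒ Z} {k : X ⇒ Y} → (id {A} #₁ h) ∘ (id #₁ k) ≈ id #₁ (h ∘ k)
  id#-∘ = ≈-trans #-∘ (identityˡ ⟩#⟨ ≈-refl)

  id#-≈-id : ∀ {A X} {h : X ⇒ X} → h ≈ id → id {A} #₁ h ≈ id
  id#-≈-id p = ≈-trans (≈-refl ⟩#⟨ p) #-identity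

  #-decomposeˡ : ∀ {A B X Y} {f : A ⇒ B} {g : X ⇒ Y} → f #₁ g ≈ (f #₁ id) ∘ (id #₁ g)
  #-decomposeˡ = ≈-trans (≈-sym identityʳ ⟩#⟨ ≈-sym identityˡ) #-homomorphism

  #-decomposeʳ : ∀ {A B X Y} {f : A ⇒ B} {g : X ⇒ Y} → f #₁ g ≈ (id #₁ g) ∘ (f #₁ id)
  #-decomposeʳ = ≈-trans (≈-sym identityˡ ⟩#⟨ ≈-sym identityʳ) #-homomorphism

  #-interchange : ∀ {A B X Y} {f : A ⇒ B} {g : X ⇒ Y} →
                  (f #₁ id) ∘ (id #₁ g) ≈ (id #₁ g) ∘ (f #₁ id)
  #-interchange = ≈-trans (≈-sym #-decomposeˡ) #-decomposeʳ

  u-natural₂ : ∀ {A B X Y} {f : A ⇒ B} {g : X ⇒ Y} → (f #₁ g) ∘ u X A ≈ u Y B ∘ f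
  u-natural₂ {f = f} {g} = begin
    (f #₁ g) ∘ u _ _                ≈⟨ pushˡ #-decomposeʳ ⟩
    (id #₁ g) ∘ (f #₁ id) ∘ u _ _   ≈⟨ refl⟩∘⟨ u-natural f ⟩
    (id #₁ g) ∘ u _ _ ∘ f           ≈⟨ pullˡ (mm-unit g) ⟩
    u _ _ ∘ f                       ∎

module ElgotTheory {o ℓ ℓe} (C : Category o ℓ ℓe) (cp : FiniteCoproducts C)
                   (P : ParametrizedMonad C) where
  open Category C
  open FiniteCoproducts cp
  open ParametrizedMonad P
  open CategoryReasoning C
  open ParametrizedMonadLemmas P
  open Elgot C cp P
  open CompleteElgot

  +-ext : ∀ {A B D} {h k : A + B ⇒ D} → h ∘ inl ≈ k ∘ inl → h ∘ inr ≈ k ∘ inr → h ≈ k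
  +-ext p q = ≈-trans (≈-sym ([]-unique ≈-refl ≈-refl)) ([]-unique (≈-sym p) (≈-sym q))

  ■-inl : ∀ {A X Y} {f : Y ⇒ A # Y} {g : X ⇒ Y # X} → (f ■ g) ∘ inl ≈ (id #₁ inl) ∘ f
  ■-inl {f = f} {g} = begin
    (m _ _ ∘ (((id #₁ inl) ∘ f) #₁ inr) ∘ [ u _ _ , g ]) ∘ inl ≈⟨ pullʳ (pullʳ inject₁) ⟩
    m _ _ ∘ (((id #₁ inl) ∘ f) #₁ inr) ∘ u _ _                ≈⟨ refl⟩∘⟨ u-natural₂ ⟩
    m _ _ ∘ u _ _ ∘ (id #₁ inl) ∘ f                           ≈⟨ cancelˡ identityˡ-m ⟩
    (id #₁ inl) ∘ f                                           ∎

  ■-inr : ∀ {A X Y} {f : Y ⇒ A # Y} {g : X ⇒ Y # X} →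
          (f ■ g) ∘ inr ≈ m _ _ ∘ (((id #₁ inl) ∘ f) #₁ inr) ∘ g
  ■-inr = pullʳ (pullʳ inject₂)

  id#-■-inl : ∀ {A X Y Z} {f : Y ⇒ A # Y} {g : X ⇒ Y # X} (h : Y + X ⇒ Z) →
              (id #₁ h) ∘ (f ■ g) ∘ inl ≈ (id #₁ (h ∘ inl)) ∘ f
  id#-■-inl h = ≈-trans (refl⟩∘⟨ ■-inl) (pullˡ id#-∘)

  id#-■-inr : ∀ {A X Y Z} {f : Y ⇒ A # Y} {g : X ⇒ Y # X} (h : Y + X ⇒ Z) →
              (id #₁ h) ∘ (f ■ g) ∘ inr ≈ m Z A ∘ (((id #₁ (h ∘ inl)) ∘ f) #₁ (h ∘ inr)) ∘ g
  id#-■-inr {f = f} {g} h = begin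
    (id #₁ h) ∘ (f ■ g) ∘ inr                                    ≈⟨ refl⟩∘⟨ ■-inr ⟩
    (id #₁ h) ∘ m _ _ ∘ (((id #₁ inl) ∘ f) #₁ inr) ∘ g            ≈⟨ pullˡ (mm-mult h) ⟩
    (m _ _ ∘ ((id #₁ h) #₁ h)) ∘ (((id #₁ inl) ∘ f) #₁ inr) ∘ g   ≈⟨ pullʳ (pullˡ #-∘) ⟩
    m _ _ ∘ (((id #₁ h) ∘ (id #₁ inl) ∘ f) #₁ (h ∘ inr)) ∘ g      ≈⟨ refl⟩∘⟨ (pullˡ id#-∘ ⟩#⟨ ≈-refl) ⟩∘⟨refl ⟩
    m _ _ ∘ (((id #₁ (h ∘ inl)) ∘ f) #₁ (h ∘ inr)) ∘ g            ∎

  ■-natural : ∀ {A B X Y} (g : A ⇒ B) {f : Y ⇒ A # Y} {e : X ⇒ Y # X} →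
              ((g #₁ id) ∘ f) ■ e ≈ (g #₁ id) ∘ (f ■ e)
  ■-natural g {f} {e} = begin
    m _ _ ∘ (((id #₁ inl) ∘ (g #₁ id) ∘ f) #₁ inr) ∘ [ u _ _ , e ]
      ≈⟨ refl⟩∘⟨ (relabel ⟩#⟨ ≈-sym identityˡ) ⟩∘⟨refl ⟩
    m _ _ ∘ (((g #₁ id) ∘ (id #₁ inl) ∘ f) #₁ (id ∘ inr)) ∘ [ u _ _ , e ]
      ≈⟨ refl⟩∘⟨ pushˡ #-homomorphism ⟩
    m _ _ ∘ ((g #₁ id) #₁ id) ∘ (((id #₁ inl) ∘ f) #₁ inr) ∘ [ u _ _ , e ]
      ≈⟨ ≈-trans (pullˡ (m-natural g)) assoc ⟨
    (g #₁ id) ∘ (f ■ e) ∎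
    where
    relabel : (id #₁ inl) ∘ (g #₁ id) ∘ f ≈ (g #₁ id) ∘ (id #₁ inl) ∘ f
    relabel = ≈-trans (pullˡ (≈-sym #-interchange)) assoc

  -- s solves e : X → Y # X "in the coalgebra o"; for a Lambek-invertible o
  -- this says that s solves e for the algebra o⁻¹ ∘ m ∘ (o # id).
  IsSolutionIn : ∀ {A X Y} → Y ⇒ A # Y → X ⇒ Y # X → X ⇒ Y → Set ℓe
  IsSolutionIn {A} {Y = Y} o e s = o ∘ s ≈ m Y A ∘ (o #₁ s) ∘ e

  algebra-solution⇒IsSolutionIn : ∀ {A X Y} {o : Y ⇒ A # Y} {a : Y # Y ⇒ Y}
                                    {e : X ⇒ Y # X} {s : X ⇒ Y} →
                                  o ∘ a ≈ m Y A ∘ (o #₁ id) → s ≈ a ∘ (id #₁ s) ∘ e →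
                                  IsSolutionIn o e s
  algebra-solution⇒IsSolutionIn {o = o} {a} {e} {s} oa p = begin
    o ∘ s                               ≈⟨ refl⟩∘⟨ p ⟩
    o ∘ a ∘ (id #₁ s) ∘ e               ≈⟨ pullˡ oa ⟩
    (m _ _ ∘ (o #₁ id)) ∘ (id #₁ s) ∘ e ≈⟨ pullʳ (pullˡ (≈-sym #-decomposeˡ)) ⟩
    m _ _ ∘ (o #₁ s) ∘ e                ∎

  ■-morphism⇒IsSolutionIn : ∀ {A X Y} {o : Y ⇒ A # Y} {e : X ⇒ Y # X} {h : Y + X ⇒ Y} →
                            o ∘ h ≈ (id #₁ h) ∘ (o ■ e) → h ∘ inl ≈ id →
                            IsSolutionIn o e (h ∘ inr)
  ■-morphism⇒IsSolutionIn {o = o} {e} {h} p q = begin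
    o ∘ h ∘ inr                                          ≈⟨ pullˡ p ⟩
    ((id #₁ h) ∘ (o ■ e)) ∘ inr                          ≈⟨ assoc ⟩
    (id #₁ h) ∘ (o ■ e) ∘ inr                            ≈⟨ id#-■-inr h ⟩
    m _ _ ∘ (((id #₁ (h ∘ inl)) ∘ o) #₁ (h ∘ inr)) ∘ e   ≈⟨ refl⟩∘⟨ (elimˡ (id#-≈-id q) ⟩#⟨ ≈-refl) ⟩∘⟨refl ⟩
    m _ _ ∘ (o #₁ (h ∘ inr)) ∘ e                         ∎

  IsSolutionIn⇒■-morphism : ∀ {A X Y} {o : Y ⇒ A # Y} {e : X ⇒ Y # X} {s : X ⇒ Y} →
                            IsSolutionIn o e s → o ∘ [ id , s ] ≈ (id #₁ [ id , s ]) ∘ (o ■ e)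
  IsSolutionIn⇒■-morphism {o = o} {e} {s} p = +-ext
    (begin
      (o ∘ [ id , s ]) ∘ inl              ≈⟨ pullʳ inject₁ ⟩
      o ∘ id                              ≈⟨ identityʳ ⟩
      o                                   ≈⟨ elimˡ (id#-≈-id inject₁) ⟨
      (id #₁ ([ id , s ] ∘ inl)) ∘ o      ≈⟨ id#-■-inl [ id , s ] ⟨
      (id #₁ [ id , s ]) ∘ (o ■ e) ∘ inl  ≈⟨ sym-assoc ⟩
      ((id #₁ [ id , s ]) ∘ (o ■ e)) ∘ inl ∎)
    (begin
      (o ∘ [ id , s ]) ∘ inr              ≈⟨ pullʳ inject₂ ⟩
      o ∘ s                               ≈⟨ p ⟩
      m _ _ ∘ (o #₁ s) ∘ e                ≈⟨ refl⟩∘⟨ (elimˡ (id#-≈-id inject₁) ⟩#⟨ inject₂) ⟩∘⟨refl ⟨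
      m _ _ ∘ (((id #₁ ([ id , s ] ∘ inl)) ∘ o) #₁ ([ id , s ] ∘ inr)) ∘ e
                                          ≈⟨ id#-■-inr [ id , s ] ⟨
      (id #₁ [ id , s ]) ∘ (o ■ e) ∘ inr  ≈⟨ sym-assoc ⟩
      ((id #₁ [ id , s ]) ∘ (o ■ e)) ∘ inr ∎)

  relabel-morphism : ∀ {A B X Y} (g : A ⇒ B) {c : X ⇒ A # X} {o : Y ⇒ A # Y} {k : X ⇒ Y} →
                     o ∘ k ≈ (id #₁ k) ∘ c → ((g #₁ id) ∘ o) ∘ k ≈ (id #₁ k) ∘ (g #₁ id) ∘ c
  relabel-morphism g p = ≈-trans (pullʳ p) (≈-trans (pullˡ #-interchange) assoc)

  †-resp-≈ : ∀ (B : CompleteElgot) {X} {e e' : X ⇒ carrier B # X} →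
             e ≈ e' → dagger B e ≈ dagger B e'
  †-resp-≈ B {e = e} {e'} p = ≈-trans (≈-sym identityʳ)
    (functoriality e' e id (≈-trans identityʳ (≈-trans p (≈-sym (elimˡ #-identity)))))
    where open IsCompleteElgot (isCompleteElgot B)

  IsMorphism-id : ∀ (A : CompleteElgot) → IsMorphism A A id
  IsMorphism-id A e = ≈-trans (†-resp-≈ A (elimˡ #-identity)) (≈-sym identityˡ)

  IsMorphism-∘ : ∀ {A B D : CompleteElgot} {g : carrier B ⇒ carrier D} {f : carrier A ⇒ carrier B} →
                 IsMorphism B D g → IsMorphism A B f → IsMorphism A D (g ∘ f)
  IsMorphism-∘ {A} {B} {D} {g} {f} g-mor f-mor e = begin
    dagger D (((g ∘ f) #₁ id) ∘ e)          ≈⟨ †-resp-≈ D (pushˡ #id-∘) ⟩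
    dagger D ((g #₁ id) ∘ (f #₁ id) ∘ e)    ≈⟨ g-mor _ ⟩
    g ∘ dagger B ((f #₁ id) ∘ e)            ≈⟨ refl⟩∘⟨ f-mor e ⟩
    g ∘ f ∘ dagger A e                      ≈⟨ sym-assoc ⟩
    (g ∘ f) ∘ dagger A e                    ∎

  IsFree-unique : ∀ {A F} {η : A ⇒ carrier F} → IsFree A F η → ∀ B {h h' : carrier F ⇒ carrier B} →
                  IsMorphism F B h → IsMorphism F B h' → h ∘ η ≈ h' ∘ η → h ≈ h'
  IsFree-unique {η = η} free B {h} {h'} h-mor h'-mor p with free B (h' ∘ η)
  ... | _ , _ , _ , unique = ≈-trans (unique h h-mor p) (≈-sym (unique h' h'-mor ≈-refl))

  -- The algebra structure is recovered from the dagger: alg B ≈ (alg-system B)† ∘ inr.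
  alg-system : ∀ (B : CompleteElgot) →
               carrier B + carrier B # carrier B ⇒ carrier B # (carrier B + carrier B # carrier B)
  alg-system B = [ u _ _ , id #₁ inl ]

  module _ (B : CompleteElgot) where
    open IsCompleteElgot (isCompleteElgot B)

    alg-system†-inl : dagger B (alg-system B) ∘ inl ≈ id
    alg-system†-inl = begin
      dagger B (alg-system B) ∘ inl                                          ≈⟨ solution _ ⟩∘⟨refl ⟩
      (alg B ∘ (id #₁ dagger B (alg-system B)) ∘ alg-system B) ∘ inl         ≈⟨ pullʳ (pullʳ inject₁) ⟩
      alg B ∘ (id #₁ dagger B (alg-system B)) ∘ u _ _                        ≈⟨ refl⟩∘⟨ mm-unit _ ⟩
      alg B ∘ u _ _                                                          ≈⟨ unit-law ⟩
      id                                                                     ∎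

    alg-system†-inr : dagger B (alg-system B) ∘ inr ≈ alg B
    alg-system†-inr = begin
      dagger B (alg-system B) ∘ inr                                          ≈⟨ solution _ ⟩∘⟨refl ⟩
      (alg B ∘ (id #₁ dagger B (alg-system B)) ∘ alg-system B) ∘ inr         ≈⟨ pullʳ (pullʳ inject₂) ⟩
      alg B ∘ (id #₁ dagger B (alg-system B)) ∘ (id #₁ inl)                  ≈⟨ refl⟩∘⟨ id#-∘ ⟩
      alg B ∘ (id #₁ (dagger B (alg-system B) ∘ inl))                        ≈⟨ elimʳ (id#-≈-id alg-system†-inl) ⟩
      alg B                                                                  ∎

  IsMorphism⇒homomorphism : ∀ (A B : CompleteElgot) {h : carrier A ⇒ carrier B} →
                            IsMorphism A B h → h ∘ alg A ≈ alg B ∘ (h #₁ h)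
  IsMorphism⇒homomorphism A B {h} h-mor = begin
    h ∘ alg A                                              ≈⟨ refl⟩∘⟨ alg-system†-inr A ⟨
    h ∘ dagger A (alg-system A) ∘ inr                      ≈⟨ ≈-trans (h-mor _ ⟩∘⟨refl) assoc ⟨
    dagger B ((h #₁ id) ∘ alg-system A) ∘ inr              ≈⟨ functoriality _ _ k k-morphism ⟩∘⟨refl ⟨
    (dagger B (alg-system B) ∘ k) ∘ inr                    ≈⟨ pullʳ inject₂ ⟩
    dagger B (alg-system B) ∘ inr ∘ (h #₁ h)               ≈⟨ pullˡ (alg-system†-inr B) ⟩
    alg B ∘ (h #₁ h)                                       ∎
    where
    open IsCompleteElgot (isCompleteElgot B)
    k : carrier A + carrier A # carrier A ⇒ carrier B + carrier B # carrier B
    k = [ inl ∘ h , inr ∘ (h #₁ h) ]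
    relabelled : ∀ {Z} {x : Z ⇒ carrier A # (carrier A + carrier A # carrier A)} →
                 ((id #₁ k) ∘ (h #₁ id) ∘ x) ≈ (h #₁ k) ∘ x
    relabelled = pullˡ (≈-sym #-decomposeʳ)
    k-morphism : alg-system B ∘ k ≈ (id #₁ k) ∘ (h #₁ id) ∘ alg-system A
    k-morphism = +-ext
      (begin
        (alg-system B ∘ k) ∘ inl                     ≈⟨ pullʳ inject₁ ⟩
        alg-system B ∘ inl ∘ h                       ≈⟨ pullˡ inject₁ ⟩
        u _ _ ∘ h                                    ≈⟨ u-natural₂ ⟨
        (h #₁ k) ∘ u _ _                             ≈⟨ relabelled ⟨
        (id #₁ k) ∘ (h #₁ id) ∘ u _ _                ≈⟨ pullʳ (pullʳ inject₁) ⟨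
        ((id #₁ k) ∘ (h #₁ id) ∘ alg-system A) ∘ inl ∎)
      (begin
        (alg-system B ∘ k) ∘ inr                     ≈⟨ pullʳ inject₂ ⟩
        alg-system B ∘ inr ∘ (h #₁ h)                ≈⟨ pullˡ inject₂ ⟩
        (id #₁ inl) ∘ (h #₁ h)                       ≈⟨ #-∘ ⟩
        (id ∘ h) #₁ (inl ∘ h)                        ≈⟨ ≈-trans identityˡ (≈-sym identityʳ) ⟩#⟨ ≈-sym inject₁ ⟩
        (h ∘ id) #₁ (k ∘ inl)                        ≈⟨ #-∘ ⟨
        (h #₁ k) ∘ (id #₁ inl)                       ≈⟨ relabelled ⟨
        (id #₁ k) ∘ (h #₁ id) ∘ (id #₁ inl)          ≈⟨ pullʳ (pullʳ inject₂) ⟨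
        ((id #₁ k) ∘ (h #₁ id) ∘ alg-system A) ∘ inr ∎)

  unique-solutions⇒IsCompleteElgot :
    ∀ {A} (a : A # A ⇒ A) (_† : ∀ {X} → X ⇒ A # X → X ⇒ A) →
    a ∘ u A A ≈ id → a ∘ (a #₁ id) ≈ a ∘ m A A →
    (∀ {X} (e : X ⇒ A # X) → e † ≈ a ∘ (id #₁ (e †)) ∘ e) →
    (∀ {X} (e : X ⇒ A # X) (s : X ⇒ A) → s ≈ a ∘ (id #₁ s) ∘ e → s ≈ e †) →
    IsCompleteElgot A a _†
  unique-solutions⇒IsCompleteElgot {A} a _† unit-law mult-law solution unique = record
    { unit-law = unit-law ; mult-law = mult-law ; solution = solution
    ; functoriality = functoriality ; compositionality = compositionality }
    where
    functoriality : ∀ {X Y} (e : X ⇒ A # X) (f : Y ⇒ A # Y) (h : X ⇒ Y) →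
                    f ∘ h ≈ (id #₁ h) ∘ e → (f †) ∘ h ≈ e †
    functoriality e f h p = unique e ((f †) ∘ h) (begin
      (f †) ∘ h                         ≈⟨ solution f ⟩∘⟨refl ⟩
      (a ∘ (id #₁ (f †)) ∘ f) ∘ h       ≈⟨ pullʳ (pullʳ p) ⟩
      a ∘ (id #₁ (f †)) ∘ (id #₁ h) ∘ e ≈⟨ refl⟩∘⟨ pullˡ id#-∘ ⟩
      a ∘ (id #₁ ((f †) ∘ h)) ∘ e       ∎)

    compositionality : ∀ {X Y} (f : Y ⇒ A # Y) (g : X ⇒ Y # X) →
                       ((f ■ g) †) ∘ inr ≈ ((f †) • g) †
    compositionality f g = unique _ (s ∘ inr) (begin
      s ∘ inr                                                          ≈⟨ solution (f ■ g) ⟩∘⟨refl ⟩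
      (a ∘ (id #₁ s) ∘ (f ■ g)) ∘ inr                                  ≈⟨ pullʳ (pullʳ ■-inr) ⟩
      a ∘ (id #₁ s) ∘ m _ _ ∘ (((id #₁ inl) ∘ f) #₁ inr) ∘ g           ≈⟨ refl⟩∘⟨ pullˡ (mm-mult s) ⟩
      a ∘ (m _ _ ∘ ((id #₁ s) #₁ s)) ∘ (((id #₁ inl) ∘ f) #₁ inr) ∘ g  ≈⟨ refl⟩∘⟨ assoc ⟩
      a ∘ m _ _ ∘ ((id #₁ s) #₁ s) ∘ (((id #₁ inl) ∘ f) #₁ inr) ∘ g    ≈⟨ pullˡ (≈-sym mult-law) ⟩
      (a ∘ (a #₁ id)) ∘ ((id #₁ s) #₁ s) ∘ (((id #₁ inl) ∘ f) #₁ inr) ∘ g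
                                                                       ≈⟨ pullʳ (pullˡ #-∘) ⟩
      a ∘ ((a ∘ (id #₁ s)) #₁ (id ∘ s)) ∘ (((id #₁ inl) ∘ f) #₁ inr) ∘ g
                                                                       ≈⟨ refl⟩∘⟨ pullˡ #-∘ ⟩
      a ∘ (((a ∘ (id #₁ s)) ∘ (id #₁ inl) ∘ f) #₁ ((id ∘ s) ∘ inr)) ∘ g
                                                                       ≈⟨ refl⟩∘⟨ (s-inl ⟩#⟨ (identityˡ ⟩∘⟨refl)) ⟩∘⟨refl ⟩
      a ∘ ((f †) #₁ (s ∘ inr)) ∘ g                                     ≈⟨ refl⟩∘⟨ pushˡ #-decomposeʳ ⟩
      a ∘ (id #₁ (s ∘ inr)) ∘ ((f †) #₁ id) ∘ g                        ∎)
      where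
      s = (f ■ g) †
      s-inl-solves : s ∘ inl ≈ a ∘ (id #₁ (s ∘ inl)) ∘ f
      s-inl-solves = begin
        s ∘ inl                            ≈⟨ solution (f ■ g) ⟩∘⟨refl ⟩
        (a ∘ (id #₁ s) ∘ (f ■ g)) ∘ inl    ≈⟨ pullʳ (pullʳ ■-inl) ⟩
        a ∘ (id #₁ s) ∘ (id #₁ inl) ∘ f    ≈⟨ refl⟩∘⟨ pullˡ id#-∘ ⟩
        a ∘ (id #₁ (s ∘ inl)) ∘ f          ∎
      s-inl : (a ∘ (id #₁ s)) ∘ (id #₁ inl) ∘ f ≈ f †
      s-inl = begin
        (a ∘ (id #₁ s)) ∘ (id #₁ inl) ∘ f  ≈⟨ pullʳ (pullˡ id#-∘) ⟩
        a ∘ (id #₁ (s ∘ inl)) ∘ f          ≈⟨ s-inl-solves ⟨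
        s ∘ inl                            ≈⟨ unique f _ s-inl-solves ⟩
        f †                                ∎

  -- In both directions of the theorem the extension of g : A → B is ((g # id) ∘ o)†
  -- for a coalgebra o with a point x, o ∘ x ≈ u, playing the role of the unit.
  dagger-relabel-point : ∀ (B : CompleteElgot) {A Y} (g : A ⇒ carrier B)
                           {o : Y ⇒ A # Y} {x : A ⇒ Y} →
                         o ∘ x ≈ u Y A → dagger B ((g #₁ id) ∘ o) ∘ x ≈ g
  dagger-relabel-point B {Y = Y} g {o} {x} p = begin
    h ∘ x                                        ≈⟨ solution _ ⟩∘⟨refl ⟩
    (alg B ∘ (id #₁ h) ∘ (g #₁ id) ∘ o) ∘ x      ≈⟨ pullʳ (pullʳ (pullʳ p)) ⟩
    alg B ∘ (id #₁ h) ∘ (g #₁ id) ∘ u _ _        ≈⟨ refl⟩∘⟨ pullˡ (≈-sym #-decomposeʳ) ⟩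
    alg B ∘ (g #₁ h) ∘ u _ _                     ≈⟨ refl⟩∘⟨ u-natural₂ ⟩
    alg B ∘ u _ _ ∘ g                            ≈⟨ cancelˡ unit-law ⟩
    g                                            ∎
    where
    open IsCompleteElgot (isCompleteElgot B)
    h : Y ⇒ carrier B
    h = dagger B ((g #₁ id) ∘ o)

  dagger-relabel-inr : ∀ (B : CompleteElgot) {A X Y} (g : A ⇒ carrier B)
                         {o : Y ⇒ A # Y} {e : X ⇒ Y # X} {k : Y + X ⇒ Y} →
                       o ∘ k ≈ (id #₁ k) ∘ (o ■ e) →
                       dagger B ((dagger B ((g #₁ id) ∘ o) #₁ id) ∘ e)
                         ≈ dagger B ((g #₁ id) ∘ o) ∘ k ∘ inr
  dagger-relabel-inr B {Y = Y} g {o} {e} {k} p = begin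
    dagger B ((dagger B f) • e)    ≈⟨ compositionality f e ⟨
    dagger B (f ■ e) ∘ inr         ≈⟨ functoriality (f ■ e) f k f-morphism ⟩∘⟨refl ⟨
    (dagger B f ∘ k) ∘ inr         ≈⟨ assoc ⟩
    dagger B f ∘ k ∘ inr           ∎
    where
    open IsCompleteElgot (isCompleteElgot B)
    f : Y ⇒ carrier B # Y
    f = (g #₁ id) ∘ o
    f-morphism : f ∘ k ≈ (id #₁ k) ∘ (f ■ e)
    f-morphism = ≈-trans (relabel-morphism g p) (refl⟩∘⟨ ≈-sym (■-natural g))

  module FinalCoalgebraLemmas {A} (F : FinalCoalgebra A) where
    open FinalCoalgebra F

    coit-unique₂ : ∀ {X} {c : X ⇒ A # X} {h h' : X ⇒ Φ} →
                   out ∘ h ≈ (id #₁ h) ∘ c → out ∘ h' ≈ (id #₁ h') ∘ c → h ≈ h'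
    coit-unique₂ p q = ≈-trans (coit-unique _ _ p) (≈-sym (coit-unique _ _ q))

    out-id-morphism : out ∘ id ≈ (id #₁ id) ∘ out
    out-id-morphism = ≈-trans identityʳ (≈-sym (elimˡ #-identity))

    out⁻¹∘out : out⁻¹ ∘ out ≈ id
    out⁻¹∘out = coit-unique₂
      (begin
        out ∘ out⁻¹ ∘ out                    ≈⟨ pullˡ (coit-hom _) ⟩
        ((id #₁ out⁻¹) ∘ (id #₁ out)) ∘ out  ≈⟨ id#-∘ ⟩∘⟨refl ⟩
        (id #₁ (out⁻¹ ∘ out)) ∘ out          ∎)
      out-id-morphism

    out∘out⁻¹ : out ∘ out⁻¹ ≈ id
    out∘out⁻¹ = begin
      out ∘ out⁻¹                  ≈⟨ coit-hom _ ⟩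
      (id #₁ out⁻¹) ∘ (id #₁ out)  ≈⟨ id#-∘ ⟩
      id #₁ (out⁻¹ ∘ out)          ≈⟨ id#-≈-id out⁻¹∘out ⟩
      id                           ∎

  module FinalToFree (fc : ∀ A → FinalCoalgebra A) (A : Obj) where
    open FromFinal fc
    open FinalCoalgebra (fc A)
    open FinalCoalgebraLemmas (fc A)

    out∘aF : out ∘ aF A ≈ m _ _ ∘ (out #₁ id)
    out∘aF = cancelˡ out∘out⁻¹

    aF-unit : aF A ∘ u _ _ ≈ id
    aF-unit = begin
      (out⁻¹ ∘ m _ _ ∘ (out #₁ id)) ∘ u _ _  ≈⟨ pullʳ (pullʳ (u-natural out)) ⟩
      out⁻¹ ∘ m _ _ ∘ u _ _ ∘ out            ≈⟨ refl⟩∘⟨ cancelˡ identityˡ-m ⟩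
      out⁻¹ ∘ out                            ≈⟨ out⁻¹∘out ⟩
      id                                     ∎

    aF-mult : aF A ∘ (aF A #₁ id) ≈ aF A ∘ m _ _
    aF-mult = begin
      (out⁻¹ ∘ m _ _ ∘ (out #₁ id)) ∘ (aF A #₁ id)        ≈⟨ pullʳ (pullʳ (≈-sym #id-∘)) ⟩
      out⁻¹ ∘ m _ _ ∘ ((out ∘ aF A) #₁ id)                ≈⟨ refl⟩∘⟨ refl⟩∘⟨ (out∘aF ⟩#⟨ ≈-refl) ⟩
      out⁻¹ ∘ m _ _ ∘ ((m _ _ ∘ (out #₁ id)) #₁ id)       ≈⟨ refl⟩∘⟨ refl⟩∘⟨ #id-∘ ⟩
      out⁻¹ ∘ m _ _ ∘ (m _ _ #₁ id) ∘ ((out #₁ id) #₁ id) ≈⟨ refl⟩∘⟨ ≈-trans (pullˡ assoc-m) assoc ⟩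
      out⁻¹ ∘ m _ _ ∘ m _ _ ∘ ((out #₁ id) #₁ id)         ≈⟨ refl⟩∘⟨ refl⟩∘⟨ m-natural out ⟨
      out⁻¹ ∘ m _ _ ∘ (out #₁ id) ∘ m _ _                 ≈⟨ pullʳ assoc ⟨
      aF A ∘ m _ _                                        ∎

    IsSolutionIn⇒aF-solution : ∀ {X} {e : X ⇒ ΦF A # X} {s : X ⇒ ΦF A} →
                               IsSolutionIn out e s → s ≈ aF A ∘ (id #₁ s) ∘ e
    IsSolutionIn⇒aF-solution {e = e} {s} p = begin
      s                                             ≈⟨ cancelˡ out⁻¹∘out ⟨
      out⁻¹ ∘ out ∘ s                               ≈⟨ refl⟩∘⟨ p ⟩
      out⁻¹ ∘ m _ _ ∘ (out #₁ s) ∘ e                ≈⟨ refl⟩∘⟨ refl⟩∘⟨ pushˡ #-decomposeˡ ⟩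
      out⁻¹ ∘ m _ _ ∘ (out #₁ id) ∘ (id #₁ s) ∘ e   ≈⟨ pullʳ assoc ⟨
      aF A ∘ (id #₁ s) ∘ e                          ∎

    cF≈■ : ∀ {X} {e : X ⇒ ΦF A # X} → cF A e ≈ out ■ e
    cF≈■ = refl⟩∘⟨ pullˡ (≈-trans #-∘ (≈-refl ⟩#⟨ identityʳ))

    coit-■-morphism : ∀ {X} (e : X ⇒ ΦF A # X) →
                      out ∘ coit (cF A e) ≈ (id #₁ coit (cF A e)) ∘ (out ■ e)
    coit-■-morphism e = ≈-trans (coit-hom _) (refl⟩∘⟨ cF≈■)

    coit-■-inl : ∀ {X} (e : X ⇒ ΦF A # X) → coit (cF A e) ∘ inl ≈ id
    coit-■-inl e = coit-unique₂
      (≈-trans (pullˡ (coit-■-morphism e)) (≈-trans assoc (id#-■-inl _)))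
      out-id-morphism

    daggerF-solves : ∀ {X} (e : X ⇒ ΦF A # X) → IsSolutionIn out e (daggerF A e)
    daggerF-solves e = ■-morphism⇒IsSolutionIn (coit-■-morphism e) (coit-■-inl e)

    IsSolutionIn⇒daggerF : ∀ {X} {e : X ⇒ ΦF A # X} {s : X ⇒ ΦF A} →
                           IsSolutionIn out e s → s ≈ daggerF A e
    IsSolutionIn⇒daggerF {e = e} {s} p = begin
      s                      ≈⟨ inject₂ ⟨
      [ id , s ] ∘ inr       ≈⟨ coit-unique _ _ (≈-trans (IsSolutionIn⇒■-morphism p) (refl⟩∘⟨ ≈-sym cF≈■)) ⟩∘⟨refl ⟩
      coit (cF A e) ∘ inr    ∎

    aF-isCompleteElgot : IsCompleteElgot (ΦF A) (aF A) (daggerF A)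
    aF-isCompleteElgot = unique-solutions⇒IsCompleteElgot (aF A) (daggerF A) aF-unit aF-mult
      (λ e → IsSolutionIn⇒aF-solution (daggerF-solves e))
      (λ e s p → IsSolutionIn⇒daggerF (algebra-solution⇒IsSolutionIn out∘aF p))

    η : A ⇒ ΦF A
    η = out⁻¹ ∘ u _ _

    out∘η : out ∘ η ≈ u _ _
    out∘η = cancelˡ out∘out⁻¹

    daggerF-η-out : daggerF A ((η #₁ id) ∘ out) ≈ id
    daggerF-η-out = ≈-sym (IsSolutionIn⇒daggerF (begin
      out ∘ id                            ≈⟨ identityʳ ⟩
      out                                 ≈⟨ cancelˡ identityʳ-m ⟨
      m _ _ ∘ (u _ _ #₁ id) ∘ out         ≈⟨ refl⟩∘⟨ pullˡ (≈-trans #-∘ (out∘η ⟩#⟨ identityˡ)) ⟨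
      m _ _ ∘ (out #₁ id) ∘ (η #₁ id) ∘ out ∎))

    free : IsFree A (FA A aF-isCompleteElgot) η
    free B g = h , h-morphism , dagger-relabel-point B g out∘η , h-unique
      where
      Φ-alg : CompleteElgot
      Φ-alg = FA A aF-isCompleteElgot
      h : ΦF A ⇒ carrier B
      h = dagger B ((g #₁ id) ∘ out)

      h-morphism : IsMorphism Φ-alg B h
      h-morphism e = dagger-relabel-inr B g (coit-■-morphism e)

      h-unique : ∀ h' → IsMorphism Φ-alg B h' → h' ∘ η ≈ g → h' ≈ h
      h-unique h' h'-morphism h'η = begin
        h'                                           ≈⟨ elimʳ daggerF-η-out ⟨
        h' ∘ daggerF A ((η #₁ id) ∘ out)             ≈⟨ h'-morphism _ ⟨
        dagger B ((h' #₁ id) ∘ (η #₁ id) ∘ out)      ≈⟨ †-resp-≈ B (pullˡ (≈-trans #-∘ (h'η ⟩#⟨ identityˡ))) ⟩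
        h                                            ∎

  -- A # T as a complete Elgot algebra over a complete Elgot algebra T and j : A → T:
  -- a system e is solved in T after pushing it along ι, and one unfolding step is kept.
  module OverAlgebra (T : CompleteElgot) {A : Obj} (j : A ⇒ carrier T) where
    private
      T₀ : Obj
      T₀ = carrier T
      α : T₀ # T₀ ⇒ T₀
      α = alg T
      _† : ∀ {X} → X ⇒ T₀ # X → X ⇒ T₀
      _† = dagger T
    open IsCompleteElgot (isCompleteElgot T)

    ι : A # T₀ ⇒ T₀
    ι = α ∘ (j #₁ id)

    ι∘u : ι ∘ u T₀ A ≈ j
    ι∘u = ≈-trans (pullʳ (u-natural j)) (cancelˡ unit-law)

    ι∘m : ι ∘ m T₀ A ≈ α ∘ (ι #₁ id)
    ι∘m = begin
      (α ∘ (j #₁ id)) ∘ m _ _              ≈⟨ pullʳ (m-natural j) ⟩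
      α ∘ m _ _ ∘ ((j #₁ id) #₁ id)        ≈⟨ pullˡ (≈-sym mult-law) ⟩
      (α ∘ (α #₁ id)) ∘ ((j #₁ id) #₁ id)  ≈⟨ pullʳ (≈-sym #id-∘) ⟩
      α ∘ (ι #₁ id)                        ∎

    ι† : ∀ {X} → X ⇒ (A # T₀) # X → X ⇒ T₀
    ι† e = ((ι #₁ id) ∘ e) †

    β : (A # T₀) # (A # T₀) ⇒ A # T₀
    β = m T₀ A ∘ (id #₁ ι)

    _‡ : ∀ {X} → X ⇒ (A # T₀) # X → X ⇒ A # T₀
    e ‡ = m T₀ A ∘ (id #₁ ι† e) ∘ e

    ι∘‡ : ∀ {X} (e : X ⇒ (A # T₀) # X) → ι ∘ (e ‡) ≈ ι† e
    ι∘‡ e = begin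
      ι ∘ m _ _ ∘ (id #₁ ι† e) ∘ e            ≈⟨ pullˡ ι∘m ⟩
      (α ∘ (ι #₁ id)) ∘ (id #₁ ι† e) ∘ e      ≈⟨ pullʳ (pullˡ #-interchange) ⟩
      α ∘ ((id #₁ ι† e) ∘ (ι #₁ id)) ∘ e      ≈⟨ refl⟩∘⟨ assoc ⟩
      α ∘ (id #₁ ι† e) ∘ (ι #₁ id) ∘ e        ≈⟨ solution _ ⟨
      ι† e                                    ∎

    β-unit : β ∘ u _ _ ≈ id
    β-unit = ≈-trans (pullʳ (mm-unit ι)) identityˡ-m

    β-mult : β ∘ (β #₁ id) ≈ β ∘ m _ _
    β-mult = begin
      (m _ _ ∘ (id #₁ ι)) ∘ (β #₁ id)           ≈⟨ pullʳ #-∘ ⟩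
      m _ _ ∘ ((id ∘ β) #₁ (ι ∘ id))            ≈⟨ refl⟩∘⟨ (identityˡ ⟩#⟨ ≈-trans identityʳ (≈-sym identityˡ)) ⟩
      m _ _ ∘ ((m _ _ ∘ (id #₁ ι)) #₁ (id ∘ ι)) ≈⟨ refl⟩∘⟨ #-homomorphism ⟩
      m _ _ ∘ (m _ _ #₁ id) ∘ ((id #₁ ι) #₁ ι)  ≈⟨ pullˡ assoc-m ⟩
      (m _ _ ∘ m _ _) ∘ ((id #₁ ι) #₁ ι)        ≈⟨ pullʳ (≈-sym (mm-mult ι)) ⟩
      m _ _ ∘ (id #₁ ι) ∘ m _ _                 ≈⟨ sym-assoc ⟩
      β ∘ m _ _                                 ∎

    ‡-solution : ∀ {X} (e : X ⇒ (A # T₀) # X) → e ‡ ≈ β ∘ (id #₁ (e ‡)) ∘ e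
    ‡-solution e = ≈-sym (≈-trans (pullʳ (pullˡ id#-∘)) (refl⟩∘⟨ (≈-refl ⟩#⟨ ι∘‡ e) ⟩∘⟨refl))

    ‡-functoriality : ∀ {X Y} (e : X ⇒ (A # T₀) # X) (f : Y ⇒ (A # T₀) # Y) (h : X ⇒ Y) →
                      f ∘ h ≈ (id #₁ h) ∘ e → (f ‡) ∘ h ≈ e ‡
    ‡-functoriality e f h p = begin
      (m _ _ ∘ (id #₁ ι† f) ∘ f) ∘ h          ≈⟨ pullʳ (pullʳ p) ⟩
      m _ _ ∘ (id #₁ ι† f) ∘ (id #₁ h) ∘ e    ≈⟨ refl⟩∘⟨ pullˡ id#-∘ ⟩
      m _ _ ∘ (id #₁ (ι† f ∘ h)) ∘ e          ≈⟨ refl⟩∘⟨ (≈-refl ⟩#⟨ ι†-functoriality) ⟩∘⟨refl ⟩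
      e ‡                                     ∎
      where
      ι†-functoriality : ι† f ∘ h ≈ ι† e
      ι†-functoriality = functoriality _ _ h (relabel-morphism ι p)

    ‡-compositionality : ∀ {X Y} (f : Y ⇒ (A # T₀) # Y) (g : X ⇒ Y # X) →
                         ((f ■ g) ‡) ∘ inr ≈ ((f ‡) • g) ‡
    ‡-compositionality {X} {Y} f g = ≈-trans (≈-trans (pullʳ (pullʳ ■-inr)) unfold-■) (≈-sym unfold-•)
      where
      φ : Y ⇒ T₀ # Y
      φ = (ι #₁ id) ∘ f
      s : Y + X ⇒ T₀
      s = ι† (f ■ g)
      V : X ⇒ T₀
      V = ((ι† f #₁ id) ∘ g) †

      s≈ : s ≈ (φ ■ g) †
      s≈ = †-resp-≈ T (≈-sym (■-natural ι))

      unfold-■ : m _ _ ∘ (id #₁ s) ∘ m _ _ ∘ (((id #₁ inl) ∘ f) #₁ inr) ∘ g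
                 ≈ m _ _ ∘ m _ _ ∘ (((id #₁ ι† f) ∘ f) #₁ V) ∘ g
      unfold-■ = begin
        m _ _ ∘ (id #₁ s) ∘ m _ _ ∘ (((id #₁ inl) ∘ f) #₁ inr) ∘ g
          ≈⟨ refl⟩∘⟨ pullˡ (mm-mult s) ⟩
        m _ _ ∘ (m _ _ ∘ ((id #₁ s) #₁ s)) ∘ (((id #₁ inl) ∘ f) #₁ inr) ∘ g
          ≈⟨ refl⟩∘⟨ pullʳ (pullˡ #-∘) ⟩
        m _ _ ∘ m _ _ ∘ (((id #₁ s) ∘ (id #₁ inl) ∘ f) #₁ (s ∘ inr)) ∘ g
          ≈⟨ refl⟩∘⟨ refl⟩∘⟨ (pullˡ id#-∘ ⟩#⟨ s-inr) ⟩∘⟨refl ⟩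
        m _ _ ∘ m _ _ ∘ (((id #₁ (s ∘ inl)) ∘ f) #₁ V) ∘ g
          ≈⟨ refl⟩∘⟨ refl⟩∘⟨ (((≈-refl ⟩#⟨ s-inl) ⟩∘⟨refl) ⟩#⟨ ≈-refl) ⟩∘⟨refl ⟩
        m _ _ ∘ m _ _ ∘ (((id #₁ ι† f) ∘ f) #₁ V) ∘ g ∎
        where
        s-inr : s ∘ inr ≈ V
        s-inr = ≈-trans (s≈ ⟩∘⟨refl) (compositionality φ g)
        s-inl : s ∘ inl ≈ ι† f
        s-inl = ≈-trans (s≈ ⟩∘⟨refl) (functoriality φ (φ ■ g) inl ■-inl)

      unfold-• : ((f ‡) • g) ‡ ≈ m _ _ ∘ m _ _ ∘ (((id #₁ ι† f) ∘ f) #₁ V) ∘ g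
      unfold-• = begin
        m _ _ ∘ (id #₁ ι† (((f ‡) #₁ id) ∘ g)) ∘ ((f ‡) #₁ id) ∘ g
          ≈⟨ refl⟩∘⟨ (≈-refl ⟩#⟨ †-resp-≈ T (pullˡ (≈-trans #-∘ (ι∘‡ f ⟩#⟨ identityˡ)))) ⟩∘⟨refl ⟩
        m _ _ ∘ (id #₁ V) ∘ ((f ‡) #₁ id) ∘ g
          ≈⟨ refl⟩∘⟨ pullˡ (≈-sym #-decomposeʳ) ⟩
        m _ _ ∘ ((f ‡) #₁ V) ∘ g
          ≈⟨ refl⟩∘⟨ pushˡ (≈-trans (≈-refl ⟩#⟨ ≈-sym identityˡ) #-homomorphism) ⟩
        m _ _ ∘ (m _ _ #₁ id) ∘ (((id #₁ ι† f) ∘ f) #₁ V) ∘ g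
          ≈⟨ ≈-trans (pullˡ assoc-m) assoc ⟩
        m _ _ ∘ m _ _ ∘ (((id #₁ ι† f) ∘ f) #₁ V) ∘ g ∎

    A#T : CompleteElgot
    A#T = record
      { carrier = A # T₀ ; alg = β ; dagger = _‡
      ; isCompleteElgot = record
        { unit-law = β-unit ; mult-law = β-mult ; solution = ‡-solution
        ; functoriality = ‡-functoriality ; compositionality = ‡-compositionality } }

    ι-morphism : IsMorphism A#T T ι
    ι-morphism e = ≈-sym (ι∘‡ e)

  module FreeToFinal (fr : ∀ A → FreeElgot A) (A : Obj) where
    private
      Fr : CompleteElgot
      Fr = proj₁ (fr A)
      T = carrier Fr
      η : A ⇒ T
      η = proj₁ (proj₂ (fr A))
      free : IsFree A Fr η
      free = proj₂ (proj₂ (fr A))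
    open IsCompleteElgot (isCompleteElgot Fr)
    open OverAlgebra Fr η

    out : T ⇒ A # T
    out = proj₁ (free A#T (u T A))

    out-morphism : IsMorphism Fr A#T out
    out-morphism = proj₁ (proj₂ (free A#T (u T A)))

    out∘η : out ∘ η ≈ u T A
    out∘η = proj₁ (proj₂ (proj₂ (free A#T (u T A))))

    ι∘out : ι ∘ out ≈ id
    ι∘out = IsFree-unique {F = Fr} free Fr (IsMorphism-∘ {Fr} {A#T} {Fr} ι-morphism out-morphism) (IsMorphism-id Fr)
      (≈-trans (pullʳ out∘η) (≈-trans ι∘u (≈-sym identityˡ)))

    out∘α : out ∘ alg Fr ≈ m T A ∘ (out #₁ id)
    out∘α = begin
      out ∘ alg Fr                       ≈⟨ IsMorphism⇒homomorphism Fr A#T out-morphism ⟩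
      (m _ _ ∘ (id #₁ ι)) ∘ (out #₁ out) ≈⟨ pullʳ #-∘ ⟩
      m _ _ ∘ ((id ∘ out) #₁ (ι ∘ out))  ≈⟨ refl⟩∘⟨ (identityˡ ⟩#⟨ ι∘out) ⟩
      m _ _ ∘ (out #₁ id)                ∎

    coit : ∀ {X} → X ⇒ A # X → X ⇒ T
    coit c = dagger Fr ((η #₁ id) ∘ c)

    coit-hom : ∀ {X} (c : X ⇒ A # X) → out ∘ coit c ≈ (id #₁ coit c) ∘ c
    coit-hom c = begin
      out ∘ coit c                                  ≈⟨ out-morphism _ ⟨
      dagger A#T ((out #₁ id) ∘ (η #₁ id) ∘ c)      ≈⟨ †-resp-≈ A#T (pullˡ (≈-trans #-∘ (out∘η ⟩#⟨ identityˡ))) ⟩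
      m _ _ ∘ (id #₁ ι† ((u _ _ #₁ id) ∘ c)) ∘ (u _ _ #₁ id) ∘ c
        ≈⟨ refl⟩∘⟨ (≈-refl ⟩#⟨ †-resp-≈ Fr (pullˡ (≈-trans #-∘ (ι∘u ⟩#⟨ identityˡ)))) ⟩∘⟨refl ⟩
      m _ _ ∘ (id #₁ coit c) ∘ (u _ _ #₁ id) ∘ c    ≈⟨ refl⟩∘⟨ pullˡ (≈-sym #-interchange) ⟩
      m _ _ ∘ ((u _ _ #₁ id) ∘ (id #₁ coit c)) ∘ c  ≈⟨ refl⟩∘⟨ assoc ⟩
      m _ _ ∘ (u _ _ #₁ id) ∘ (id #₁ coit c) ∘ c    ≈⟨ cancelˡ identityʳ-m ⟩
      (id #₁ coit c) ∘ c                            ∎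

    η-out† : dagger Fr ((η #₁ id) ∘ out) ≈ id
    η-out† = IsFree-unique {F = Fr} free Fr η-out†-morphism (IsMorphism-id Fr)
      (≈-trans (dagger-relabel-point Fr η out∘η) (≈-sym identityˡ))
      where
      η-out†-morphism : IsMorphism Fr Fr (dagger Fr ((η #₁ id) ∘ out))
      η-out†-morphism e = ≈-trans
        (dagger-relabel-inr Fr η
          (IsSolutionIn⇒■-morphism (algebra-solution⇒IsSolutionIn out∘α (solution e))))
        (refl⟩∘⟨ inject₂)

    coit-unique : ∀ {X} (c : X ⇒ A # X) (h : X ⇒ T) → out ∘ h ≈ (id #₁ h) ∘ c → h ≈ coit c
    coit-unique c h p = begin
      h                                   ≈⟨ elimˡ η-out† ⟨
      dagger Fr ((η #₁ id) ∘ out) ∘ h     ≈⟨ functoriality _ _ h (relabel-morphism η p) ⟩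
      coit c                              ∎

    final : FinalCoalgebra A
    final = record { Φ = T ; out = out ; coit = coit ; coit-hom = coit-hom
                   ; coit-unique = coit-unique }

corollary4p22 : ∀ {o ℓ e} (C : Category o ℓ e) (cp : FiniteCoproducts C)
                  (P : ParametrizedMonad C) →
                  let open Category C
                      open Elgot C cp P
                  in ((∀ A → FreeElgot A) ⇔ (∀ A → FinalCoalgebra A))
                     × ((fc : ∀ A → FinalCoalgebra A) → ∀ A →
                          let open FromFinal fc
                          in Σ (IsCompleteElgot (ΦF A) (aF A) (daggerF A)) λ isE →
                               Σ (A ⇒ ΦF A) λ η → IsFree A (FA A isE) η)
corollary4p22 C cp P =
  mk⇔ FreeToFinal.final
      (λ fc A → FromFinal.FA fc A (aF-isCompleteElgot fc A) , η fc A , free fc A)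
  , λ fc A → aF-isCompleteElgot fc A , η fc A , free fc A
  where
  open ElgotTheory C cp P
  open Elgot C cp P
  open FinalToFree
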